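{- Let $p$ be an odd prime, $\mathbf{C}^{(p)}=(c_i)_{i\ge0}$ the $p$-Cantor sequence and $\Theta_p(t)=\sum_{i\ge0}c_it^{ -i}\in\mathbb{F}_p((t^{ -1}))$. Then $\Theta_p(t)=(1+t^{ -2})^{ -1/2}$.
   Context: $\mathbb{F}_p((t^{ -1}))$ is the field of formal Laurent series in $t^{ -1}$ over $\mathbb{F}_p$; $(1+t^{ -2})^{ -1/2}$ denotes the power series in $t^{ -1}$ with constant term $1$ whose square is $(1+t^{ -2})^{ -1}$. $p_2=(p-1)/2$; for real $a,b$, $\binom{a}{b}=\frac{a!}{b!(a-b)!}$ if $a,b$ are nonnegative integers with $a\ge b$, and $0$ otherwise. $p$-Cantor: $\phi_p$ sends each letter $n\in\{0,\dots,p-1\}$ (identified with $\mathbb{F}_p$) to the length-$p$ word with $i$-th letter $n\binom{p_2}{i/2}\bmod p$, extended by concatenation; $\mathbf{C}^{(p)}=\lim_k\phi_p^k(1)$. -}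

module Defs where

open import Data.Nat using (ℕ; zero; suc; _+_; _*_; _∸_; _^_; NonZero)
open import Data.Nat.DivMod using (_/_; _%_)
open import Data.Nat.Combinatorics using (_C_)
open import Data.List using (List; []; _∷_; map; concatMap; upTo)
open import Data.Nat.ListAction using (sum)

-- Letters of F_p are represented by naturals 0..p-1.

half : ℕ → ℕ
half p = (p ∸ 1) / 2

binomHalf : ℕ → ℕ → ℕ
binomHalf p i with i % 2
... | zero  = half p C (i / 2)
... | suc _ = 0

φletter : (p : ℕ) → .{{NonZero p}} → ℕ → List ℕ
φletter p n = map (λ i → (n * binomHalf p i) % p) (upTo p)

φword : (p : ℕ) → .{{NonZero p}} → List ℕ → List ℕ
φword p w = concatMap (φletter p) w

φiter : (p : ℕ) → .{{NonZero p}} → ℕ → List ℕ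
φiter p zero    = 1 ∷ []
φiter p (suc k) = φword p (φiter p k)

-- i-th letter of a word (0 if out of range)
at : List ℕ → ℕ → ℕ
at []       _       = 0
at (x ∷ xs) zero    = x
at (x ∷ xs) (suc i) = at xs i

-- The p-Cantor sequence C^(p) = lim_k φ_p^k(1): its i-th letter is read off
-- from φ_p^(i+1)(1), which has length p^(i+1) > i.
cantor : (p : ℕ) → .{{NonZero p}} → ℕ → ℕ
cantor p i = at (φiter p (suc i)) i

-- Formal power series in x = t^{-1} over F_p, as coefficient functions ℕ → ℕ
-- (coefficients read mod p).
Series : Set
Series = ℕ → ℕ

_⊛_ : Series → Series → Series
(f ⊛ g) n = sum (map (λ j → f j * g (n ∸ j)) (upTo (suc n)))

oneS : Series
oneS zero    = 1
oneS (suc _) = 0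

onePlusX² : Series
onePlusX² zero                = 1
onePlusX² (suc zero)          = 0
onePlusX² (suc (suc zero))    = 1
onePlusX² (suc (suc (suc _))) = 0

Θ : (p : ℕ) → .{{NonZero p}} → Series
Θ p = cantor p

-- f is (1 + x²)^{-1/2} over F_p: constant term 1 and f² = (1 + x²)^{-1},
-- i.e. f² · (1 + x²) = 1, all coefficients taken mod p.
IsInvSqrtOnePlusX² : (p : ℕ) → .{{NonZero p}} → Series → Set
IsInvSqrtOnePlusX² p f =
  (f 0 % p ≡ 1 % p) × (∀ n → (((f ⊛ f) ⊛ onePlusX²) n) % p ≡ oneS n % p)
  where
  open import Relation.Binary.PropositionalEquality using (_≡_)
  open import Data.Product using (_×_)

-- Write B = binomHalf p for (1 + x²)^((p-1)/2) and Φ f = f(x^p).  The letter at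
-- position r + qp of φ_p^(k+1)(1) is the letter at q of φ_p^k(1) times B_r, so
-- c_{r+qp} = c_q B_r, i.e. Θ = B · ΦΘ because B has degree < p.  Modulo p,
-- B²(1 + x²) = (1 + x²)^p = Φ(1 + x²) and Φ is multiplicative, hence S = Θ²(1 + x²)
-- satisfies S = ΦS.  A series fixed by Φ with constant term 1 is 1: its n-th
-- coefficient is its (n/p)-th one when p ∣ n and 0 otherwise.

module Submission where

open import Defs
open import Data.Nat using (ℕ; NonZero; zero; suc; _+_; _*_; _∸_; _<_; _≤_; _!; z≤n; z<s; s<s; s≤s⁻¹; pred; >-nonZero; >-nonZero⁻¹; nonTrivial⇒n>1)
open import Data.Nat.Properties
open import Data.Nat.DivMod
open import Data.Nat.Divisibility using (_∣_; _∤_; divides-refl; m∣m*n; ∣⇒≤; n∣m⇒m%n≡0)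
open import Data.Nat.Primality using (Prime; euclidsLemma; prime⇒nonZero; prime⇒nonTrivial)
open import Data.Nat.Combinatorics using (_C_; nCk≡n!/k![n-k]!; k![n∸k]!∣n!; nCk+nC[k+1]≡[n+1]C[k+1]; k>n⇒nCk≡0; nCn≡1)
open import Data.Nat.Induction using (<-rec)
open import Data.Nat.ListAction using (sum)
open import Data.List using ([]; _∷_; _++_; length; map; upTo; applyUpTo)
open import Data.List.Properties using (map-applyUpTo; map-upTo; length-map; length-upTo)
open import Data.Product using (_,_)
open import Data.Sum using (inj₁; inj₂)
open import Function using (_∘_)
open import Algebra.Bundles using (CommutativeMonoid)
open import Algebra.Properties.CommutativeSemigroup +-commutativeSemigroup using (interchange; x∙yz≈y∙xz)
open import Relation.Nullary using (¬_; contradiction)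
open import Relation.Binary.Definitions using (tri<; tri≈; tri>)
open import Relation.Binary.PropositionalEquality
open ≡-Reasoning

-- Finite sums and the Cauchy product

sumTo : (ℕ → ℕ) → ℕ → ℕ
sumTo φ n = sum (map φ (upTo n))

sumTo-suc : ∀ φ n → sumTo φ (suc n) ≡ φ 0 + sumTo (φ ∘ suc) n
sumTo-suc φ n =
  cong (λ xs → φ 0 + sum xs) (trans (map-applyUpTo suc φ n) (sym (map-upTo (φ ∘ suc) n)))

sumTo-cong : ∀ {φ ψ} n → (∀ j → j < n → φ j ≡ ψ j) → sumTo φ n ≡ sumTo ψ n
sumTo-cong zero eq = refl
sumTo-cong {φ} {ψ} (suc n) eq = begin
  sumTo φ (suc n)          ≡⟨ sumTo-suc φ n ⟩
  φ 0 + sumTo (φ ∘ suc) n  ≡⟨ cong₂ _+_ (eq 0 z<s) (sumTo-cong n λ j j<n → eq (suc j) (s<s j<n)) ⟩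
  ψ 0 + sumTo (ψ ∘ suc) n  ≡⟨ sumTo-suc ψ n ⟨
  sumTo ψ (suc n)          ∎

sumTo-vanishing : ∀ {φ} n → (∀ j → j < n → φ j ≡ 0) → sumTo φ n ≡ 0
sumTo-vanishing zero _ = refl
sumTo-vanishing {φ} (suc n) eq = trans (sumTo-suc φ n)
  (cong₂ _+_ (eq 0 z<s) (sumTo-vanishing n λ j j<n → eq (suc j) (s<s j<n)))

sumTo-head : ∀ {φ} n → 0 < n → (∀ j → 0 < j → j < n → φ j ≡ 0) → sumTo φ n ≡ φ 0
sumTo-head {φ} (suc n) _ eq = begin
  sumTo φ (suc n)          ≡⟨ sumTo-suc φ n ⟩
  φ 0 + sumTo (φ ∘ suc) n  ≡⟨ cong (φ 0 +_) (sumTo-vanishing n λ j j<n → eq (suc j) z<s (s<s j<n)) ⟩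
  φ 0 + 0                  ≡⟨ +-identityʳ (φ 0) ⟩
  φ 0                      ∎

sumTo-last : ∀ {φ} n → (∀ j → j < n → φ j ≡ 0) → sumTo φ (suc n) ≡ φ n
sumTo-last zero _ = +-identityʳ _
sumTo-last {φ} (suc n) eq = begin
  sumTo φ (suc (suc n))        ≡⟨ sumTo-suc φ (suc n) ⟩
  φ 0 + sumTo (φ ∘ suc) (suc n) ≡⟨ cong₂ _+_ (eq 0 z<s) (sumTo-last n λ j j<n → eq (suc j) (s<s j<n)) ⟩
  φ (suc n)                     ∎

sumTo-+ : ∀ φ m n → sumTo φ (m + n) ≡ sumTo φ m + sumTo (λ j → φ (m + j)) n
sumTo-+ φ zero n = refl
sumTo-+ φ (suc m) n = begin
  sumTo φ (suc m + n)                                        ≡⟨ sumTo-suc φ (m + n) ⟩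
  φ 0 + sumTo (φ ∘ suc) (m + n)                              ≡⟨ cong (φ 0 +_) (sumTo-+ (φ ∘ suc) m n) ⟩
  φ 0 + (sumTo (φ ∘ suc) m + sumTo (λ j → φ (suc m + j)) n)  ≡⟨ +-assoc (φ 0) _ _ ⟨
  (φ 0 + sumTo (φ ∘ suc) m) + sumTo (λ j → φ (suc m + j)) n  ≡⟨ cong (_+ sumTo (λ j → φ (suc m + j)) n) (sumTo-suc φ m) ⟨
  sumTo φ (suc m) + sumTo (λ j → φ (suc m + j)) n            ∎

sumTo-distrib-+ : ∀ φ ψ n → sumTo (λ j → φ j + ψ j) n ≡ sumTo φ n + sumTo ψ n
sumTo-distrib-+ φ ψ zero = refl
sumTo-distrib-+ φ ψ (suc n) = begin
  sumTo (λ j → φ j + ψ j) (suc n)                      ≡⟨ sumTo-suc _ n ⟩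
  (φ 0 + ψ 0) + sumTo (λ j → φ (suc j) + ψ (suc j)) n  ≡⟨ cong (_ +_) (sumTo-distrib-+ (φ ∘ suc) (ψ ∘ suc) n) ⟩
  (φ 0 + ψ 0) + (sumTo (φ ∘ suc) n + sumTo (ψ ∘ suc) n) ≡⟨ interchange (φ 0) (ψ 0) _ _ ⟩
  (φ 0 + sumTo (φ ∘ suc) n) + (ψ 0 + sumTo (ψ ∘ suc) n) ≡⟨ cong₂ _+_ (sumTo-suc φ n) (sumTo-suc ψ n) ⟨
  sumTo φ (suc n) + sumTo ψ (suc n)                     ∎

sumTo-distribˡ-* : ∀ a φ n → sumTo (λ j → a * φ j) n ≡ a * sumTo φ n
sumTo-distribˡ-* a φ zero = sym (*-zeroʳ a)
sumTo-distribˡ-* a φ (suc n) = begin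
  sumTo (λ j → a * φ j) (suc n)      ≡⟨ sumTo-suc _ n ⟩
  a * φ 0 + sumTo (λ j → a * φ (suc j)) n ≡⟨ cong (a * φ 0 +_) (sumTo-distribˡ-* a (φ ∘ suc) n) ⟩
  a * φ 0 + a * sumTo (φ ∘ suc) n    ≡⟨ *-distribˡ-+ a (φ 0) _ ⟨
  a * (φ 0 + sumTo (φ ∘ suc) n)      ≡⟨ cong (a *_) (sumTo-suc φ n) ⟨
  a * sumTo φ (suc n)                ∎

⊛-suc : ∀ f g n → (f ⊛ g) (suc n) ≡ f 0 * g (suc n) + ((f ∘ suc) ⊛ g) n
⊛-suc f g n = sumTo-suc (λ j → f j * g (suc n ∸ j)) (suc n)

⊛-cong : ∀ {f f′ g g′} → f ≗ f′ → g ≗ g′ → (f ⊛ g) ≗ (f′ ⊛ g′)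
⊛-cong f≗f′ g≗g′ n = sumTo-cong (suc n) λ j _ → cong₂ _*_ (f≗f′ j) (g≗g′ (n ∸ j))

⊛-distribʳ-+ : ∀ u v h n → ((λ k → u k + v k) ⊛ h) n ≡ (u ⊛ h) n + (v ⊛ h) n
⊛-distribʳ-+ u v h n = trans (sumTo-cong (suc n) λ j _ → *-distribʳ-+ (h (n ∸ j)) (u j) (v j))
                             (sumTo-distrib-+ (λ j → u j * h (n ∸ j)) (λ j → v j * h (n ∸ j)) (suc n))

⊛-*ˡ : ∀ a u h n → ((λ k → a * u k) ⊛ h) n ≡ a * (u ⊛ h) n
⊛-*ˡ a u h n = trans (sumTo-cong (suc n) λ j _ → *-assoc a (u j) (h (n ∸ j)))
                     (sumTo-distribˡ-* a (λ j → u j * h (n ∸ j)) (suc n))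

⊛-identityˡ : ∀ f → (oneS ⊛ f) ≗ f
⊛-identityˡ f n = trans (sumTo-head (suc n) z<s λ { (suc _) _ _ → refl }) (+-identityʳ (f n))

⊛-comm : ∀ f g → (f ⊛ g) ≗ (g ⊛ f)
⊛-comm f g zero = cong (_+ 0) (*-comm (f 0) (g 0))
⊛-comm f g (suc zero) = begin
  f 0 * g 1 + (f 1 * g 0 + 0)  ≡⟨ x∙yz≈y∙xz (f 0 * g 1) (f 1 * g 0) 0 ⟩
  f 1 * g 0 + (f 0 * g 1 + 0)  ≡⟨ cong₂ (λ a b → a + (b + 0)) (*-comm (f 1) (g 0)) (*-comm (f 0) (g 1)) ⟩
  g 0 * f 1 + (g 1 * f 0 + 0)  ∎
⊛-comm f g (suc (suc n)) = begin
  (f ⊛ g) (2 + n)                                            ≡⟨ ⊛-suc f g (suc n) ⟩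
  f 0 * g (2 + n) + (f′ ⊛ g) (suc n)                         ≡⟨ cong (f 0 * g (2 + n) +_) (⊛-comm f′ g (suc n)) ⟩
  f 0 * g (2 + n) + (g ⊛ f′) (suc n)                         ≡⟨ cong (f 0 * g (2 + n) +_) (⊛-suc g f′ n) ⟩
  f 0 * g (2 + n) + (g 0 * f (2 + n) + (g′ ⊛ f′) n)          ≡⟨ x∙yz≈y∙xz (f 0 * g (2 + n)) (g 0 * f (2 + n)) _ ⟩
  g 0 * f (2 + n) + (f 0 * g (2 + n) + (g′ ⊛ f′) n)
    ≡⟨ cong (λ x → g 0 * f (2 + n) + (f 0 * g (2 + n) + x)) (⊛-comm g′ f′ n) ⟩
  g 0 * f (2 + n) + (f 0 * g (2 + n) + (f′ ⊛ g′) n)          ≡⟨ cong (g 0 * f (2 + n) +_) (⊛-suc f g′ n) ⟨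
  g 0 * f (2 + n) + (f ⊛ g′) (suc n)                         ≡⟨ cong (g 0 * f (2 + n) +_) (⊛-comm f g′ (suc n)) ⟩
  g 0 * f (2 + n) + (g′ ⊛ f) (suc n)                         ≡⟨ ⊛-suc g f (suc n) ⟨
  (g ⊛ f) (2 + n)                                            ∎
  where
  f′ g′ : Series
  f′ = f ∘ suc
  g′ = g ∘ suc

⊛-assoc : ∀ f g h → ((f ⊛ g) ⊛ h) ≗ (f ⊛ (g ⊛ h))
⊛-assoc f g h zero = cong (_+ 0) (trans (cong (_* h 0) (+-identityʳ (f 0 * g 0)))
                                 (trans (*-assoc (f 0) (g 0) (h 0)) (cong (f 0 *_) (sym (+-identityʳ (g 0 * h 0))))))
⊛-assoc f g h (suc n) = begin
  ((f ⊛ g) ⊛ h) (suc n)                                                ≡⟨ ⊛-suc (f ⊛ g) h n ⟩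
  fg₀ * h (suc n) + (((f ⊛ g) ∘ suc) ⊛ h) n
    ≡⟨ cong (fg₀ * h (suc n) +_) (⊛-cong {g = h} (⊛-suc f g) (λ _ → refl) n) ⟩
  fg₀ * h (suc n) + ((λ k → f 0 * g (suc k) + (f′ ⊛ g) k) ⊛ h) n
    ≡⟨ cong (fg₀ * h (suc n) +_) (⊛-distribʳ-+ (λ k → f 0 * g (suc k)) (f′ ⊛ g) h n) ⟩
  fg₀ * h (suc n) + (((λ k → f 0 * g (suc k)) ⊛ h) n + ((f′ ⊛ g) ⊛ h) n)
    ≡⟨ cong₂ (λ a b → fg₀ * h (suc n) + (a + b)) (⊛-*ˡ (f 0) (g ∘ suc) h n) (⊛-assoc f′ g h n) ⟩
  fg₀ * h (suc n) + (rest + (f′ ⊛ (g ⊛ h)) n)                         ≡⟨ +-assoc (fg₀ * h (suc n)) rest ((f′ ⊛ (g ⊛ h)) n) ⟨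
  (fg₀ * h (suc n) + rest) + (f′ ⊛ (g ⊛ h)) n                         ≡⟨ cong (_+ (f′ ⊛ (g ⊛ h)) n) factor ⟩
  f 0 * (g ⊛ h) (suc n) + (f′ ⊛ (g ⊛ h)) n                            ≡⟨ ⊛-suc f (g ⊛ h) n ⟨
  (f ⊛ (g ⊛ h)) (suc n)                                                ∎
  where
  f′ : Series
  f′ = f ∘ suc
  fg₀ : ℕ
  fg₀ = (f ⊛ g) 0
  rest : ℕ
  rest = f 0 * ((g ∘ suc) ⊛ h) n
  factor : fg₀ * h (suc n) + rest ≡ f 0 * (g ⊛ h) (suc n)
  factor = begin
    (f 0 * g 0 + 0) * h (suc n) + f 0 * ((g ∘ suc) ⊛ h) n  ≡⟨ cong (λ x → x * h (suc n) + rest) (+-identityʳ (f 0 * g 0)) ⟩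
    f 0 * g 0 * h (suc n) + f 0 * ((g ∘ suc) ⊛ h) n        ≡⟨ cong (_+ rest) (*-assoc (f 0) (g 0) (h (suc n))) ⟩
    f 0 * (g 0 * h (suc n)) + f 0 * ((g ∘ suc) ⊛ h) n      ≡⟨ *-distribˡ-+ (f 0) (g 0 * h (suc n)) (((g ∘ suc) ⊛ h) n) ⟨
    f 0 * (g 0 * h (suc n) + ((g ∘ suc) ⊛ h) n)            ≡⟨ cong (f 0 *_) (⊛-suc g h n) ⟨
    f 0 * (g ⊛ h) (suc n)                                  ∎

⊛-1-commutativeMonoid : CommutativeMonoid _ _
⊛-1-commutativeMonoid = record
  { Carrier = Series
  ; _≈_ = _≗_
  ; _∙_ = _⊛_
  ; ε = oneS
  ; isCommutativeMonoid = record
    { isMonoid = record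
      { isSemigroup = record
        { isMagma = record
          { isEquivalence = record { refl = λ _ → refl ; sym = λ e n → sym (e n) ; trans = λ e e′ n → trans (e n) (e′ n) }
          ; ∙-cong = ⊛-cong
          }
        ; assoc = ⊛-assoc
        }
      ; identity = ⊛-identityˡ , λ f n → trans (⊛-comm f oneS n) (⊛-identityˡ f n)
      }
    ; comm = ⊛-comm
    }
  }

module Modulo (m : ℕ) .{{_ : NonZero m}} where

  infix 4 _≈_
  _≈_ : Series → Series → Set
  f ≈ g = ∀ n → f n % m ≡ g n % m

  ≗⇒≈ : ∀ {f g} → f ≗ g → f ≈ g
  ≗⇒≈ e n = cong (_% m) (e n)

  sumTo-cong-% : ∀ {φ ψ} n → (∀ j → j < n → φ j % m ≡ ψ j % m) → sumTo φ n % m ≡ sumTo ψ n % m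
  sumTo-cong-% zero _ = refl
  sumTo-cong-% {φ} {ψ} (suc n) eq = begin
    sumTo φ (suc n) % m                            ≡⟨ cong (_% m) (sumTo-suc φ n) ⟩
    (φ 0 + sumTo (φ ∘ suc) n) % m                  ≡⟨ %-distribˡ-+ (φ 0) _ m ⟩
    (φ 0 % m + sumTo (φ ∘ suc) n % m) % m          ≡⟨ cong₂ (λ a b → (a + b) % m) (eq 0 z<s)
                                                        (sumTo-cong-% n λ j j<n → eq (suc j) (s<s j<n)) ⟩
    (ψ 0 % m + sumTo (ψ ∘ suc) n % m) % m          ≡⟨ %-distribˡ-+ (ψ 0) _ m ⟨
    (ψ 0 + sumTo (ψ ∘ suc) n) % m                  ≡⟨ cong (_% m) (sumTo-suc ψ n) ⟨
    sumTo ψ (suc n) % m                            ∎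

  ⊛-cong-≈ : ∀ {f f′ g g′} → f ≈ f′ → g ≈ g′ → (f ⊛ g) ≈ (f′ ⊛ g′)
  ⊛-cong-≈ {f} {f′} {g} {g′} f≈f′ g≈g′ n = sumTo-cong-% (suc n) λ j _ → begin
    (f j * g (n ∸ j)) % m                ≡⟨ %-distribˡ-* (f j) (g (n ∸ j)) m ⟩
    ((f j % m) * (g (n ∸ j) % m)) % m    ≡⟨ cong₂ (λ a b → (a * b) % m) (f≈f′ j) (g≈g′ (n ∸ j)) ⟩
    ((f′ j % m) * (g′ (n ∸ j) % m)) % m  ≡⟨ %-distribˡ-* (f′ j) (g′ (n ∸ j)) m ⟨
    (f′ j * g′ (n ∸ j)) % m              ∎

  ⊛-1-commutativeMonoid-≈ : CommutativeMonoid _ _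
  ⊛-1-commutativeMonoid-≈ = record
    { Carrier = Series
    ; _≈_ = _≈_
    ; _∙_ = _⊛_
    ; ε = oneS
    ; isCommutativeMonoid = record
      { isMonoid = record
        { isSemigroup = record
          { isMagma = record
            { isEquivalence = record { refl = λ _ → refl ; sym = λ e n → sym (e n) ; trans = λ e e′ n → trans (e n) (e′ n) }
            ; ∙-cong = ⊛-cong-≈
            }
          ; assoc = λ f g h → ≗⇒≈ (⊛-assoc f g h)
          }
        ; identity = (λ f → ≗⇒≈ (identityˡ f)) , (λ f → ≗⇒≈ (identityʳ f))
        }
      ; comm = λ f g → ≗⇒≈ (⊛-comm f g)
      }
    }
    where
    open CommutativeMonoid ⊛-1-commutativeMonoid using (identityˡ; identityʳ)

-- Powers of 1 + x²

open import Algebra.Properties.Monoid.Mult (CommutativeMonoid.monoid ⊛-1-commutativeMonoid) using (_×_; ×-homo-+)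

infixr 8 _⊛^_
_⊛^_ : Series → ℕ → Series
f ⊛^ k = k × f

data Parity : ℕ → Set where
  even : ∀ j → Parity (j + j)
  odd  : ∀ j → Parity (suc (j + j))

parity : ∀ n → Parity n
parity zero = even 0
parity (suc n) with parity n
... | even j = odd j
... | odd j  = subst Parity (cong suc (+-suc j j)) (even (suc j))

j+j≡j*2 : ∀ j → j + j ≡ j * 2
j+j≡j*2 j = trans (cong (j +_) (sym (+-identityʳ j))) (*-comm 2 j)

j+j≢1+k+k : ∀ j k → j + j ≢ suc (k + k)
j+j≢1+k+k j k eq = even≢odd j k (begin
  2 * j          ≡⟨ *-comm 2 j ⟩
  j * 2          ≡⟨ j+j≡j*2 j ⟨
  j + j          ≡⟨ eq ⟩
  suc (k + k)    ≡⟨ cong suc (j+j≡j*2 k) ⟩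
  suc (k * 2)    ≡⟨ cong suc (*-comm k 2) ⟩
  suc (2 * k)    ∎)

[j+j]/2≡j : ∀ j → (j + j) / 2 ≡ j
[j+j]/2≡j j = trans (cong (_/ 2) (j+j≡j*2 j)) (m*n/n≡m j 2)

[j+j]%2≡0 : ∀ j → (j + j) % 2 ≡ 0
[j+j]%2≡0 j = trans (cong (_% 2) (j+j≡j*2 j)) (m*n%n≡0 j 2)

[1+j+j]%2≡1 : ∀ j → suc (j + j) % 2 ≡ 1
[1+j+j]%2≡1 j = trans (cong (λ x → suc x % 2) (j+j≡j*2 j)) ([m+kn]%n≡m%n 1 j 2)

binomEven : ℕ → Series
binomEven k i with i % 2
... | zero  = k C (i / 2)
... | suc _ = 0

binomHalf≗binomEven : ∀ p → binomHalf p ≗ binomEven (half p)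
binomHalf≗binomEven p i with i % 2
... | zero  = refl
... | suc _ = refl

2+j+j≡1+j+1+j : ∀ j → 2 + (j + j) ≡ suc j + suc j
2+j+j≡1+j+1+j j = cong suc (sym (+-suc j j))

binomEven-even : ∀ k j → binomEven k (j + j) ≡ k C j
binomEven-even k j = trans (evenIndex (j + j) ([j+j]%2≡0 j)) (cong (k C_) ([j+j]/2≡j j))
  where
  evenIndex : ∀ i → i % 2 ≡ 0 → binomEven k i ≡ k C (i / 2)
  evenIndex i i%2≡0 with i % 2 | i%2≡0
  ... | zero | refl = refl

binomEven-odd : ∀ k j → binomEven k (suc (j + j)) ≡ 0
binomEven-odd k j = oddIndex (suc (j + j)) ([1+j+j]%2≡1 j)
  where
  oddIndex : ∀ i → i % 2 ≡ 1 → binomEven k i ≡ 0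
  oddIndex i i%2≡1 with i % 2 | i%2≡1
  ... | suc _ | refl = refl

binomEven-zero : binomEven 0 ≗ oneS
binomEven-zero n with parity n
... | even zero    = refl
... | even (suc j) = binomEven-even 0 (suc j)
... | odd j        = binomEven-odd 0 j

binomEven-suc : ∀ k n → binomEven (suc k) (2 + n) ≡ binomEven k (2 + n) + binomEven k n
binomEven-suc k n with parity n
... | even j = begin
  binomEven (suc k) (2 + (j + j))                  ≡⟨ cong (binomEven (suc k)) (2+j+j≡1+j+1+j j) ⟩
  binomEven (suc k) (suc j + suc j)                ≡⟨ binomEven-even (suc k) (suc j) ⟩
  suc k C suc j                                    ≡⟨ nCk+nC[k+1]≡[n+1]C[k+1] k j ⟨
  k C j + k C suc j                                ≡⟨ +-comm (k C j) (k C suc j) ⟩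
  k C suc j + k C j                                ≡⟨ cong₂ _+_ (binomEven-even k (suc j)) (binomEven-even k j) ⟨
  binomEven k (suc j + suc j) + binomEven k (j + j) ≡⟨ cong (λ i → binomEven k i + binomEven k (j + j)) (2+j+j≡1+j+1+j j) ⟨
  binomEven k (2 + (j + j)) + binomEven k (j + j)  ∎
... | odd j = begin
  binomEven (suc k) (suc (2 + (j + j)))            ≡⟨ cong (binomEven (suc k) ∘ suc) (2+j+j≡1+j+1+j j) ⟩
  binomEven (suc k) (suc (suc j + suc j))          ≡⟨ binomEven-odd (suc k) (suc j) ⟩
  0                                                ≡⟨ cong₂ _+_ (binomEven-odd k (suc j)) (binomEven-odd k j) ⟨
  binomEven k (suc (suc j + suc j)) + binomEven k (suc (j + j))
    ≡⟨ cong (λ i → binomEven k (suc i) + binomEven k (suc (j + j))) (2+j+j≡1+j+1+j j) ⟨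
  binomEven k (suc (2 + (j + j))) + binomEven k (suc (j + j)) ∎

onePlusX²-⊛ : ∀ f n → (onePlusX² ⊛ f) (2 + n) ≡ f (2 + n) + f n
onePlusX²-⊛ f n = begin
  (onePlusX² ⊛ f) (2 + n)                               ≡⟨ ⊛-suc onePlusX² f (suc n) ⟩
  1 * f (2 + n) + ((onePlusX² ∘ suc) ⊛ f) (suc n)       ≡⟨ cong (1 * f (2 + n) +_) (⊛-suc (onePlusX² ∘ suc) f n) ⟩
  1 * f (2 + n) + (0 * f (suc n) + (x² ⊛ f) n)
    ≡⟨ cong₂ _+_ (*-identityˡ (f (2 + n))) (⊛-cong {g = f} x²≗1 (λ _ → refl) n) ⟩
  f (2 + n) + (oneS ⊛ f) n                              ≡⟨ cong (f (2 + n) +_) (⊛-identityˡ f n) ⟩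
  f (2 + n) + f n                                       ∎
  where
  x² : Series
  x² = onePlusX² ∘ suc ∘ suc
  x²≗1 : x² ≗ oneS
  x²≗1 zero    = refl
  x²≗1 (suc _) = refl

onePlusX²^≗binomEven : ∀ k → onePlusX² ⊛^ k ≗ binomEven k
onePlusX²^≗binomEven zero n = sym (binomEven-zero n)
onePlusX²^≗binomEven (suc k) zero = trans (+-identityʳ _) (trans (+-identityʳ _) (onePlusX²^≗binomEven k 0))
onePlusX²^≗binomEven (suc k) (suc zero) = trans (+-identityʳ _) (trans (+-identityʳ _) (onePlusX²^≗binomEven k 1))
onePlusX²^≗binomEven (suc k) (suc (suc n)) = begin
  (onePlusX² ⊛^ suc k) (2 + n)                    ≡⟨ onePlusX²-⊛ (onePlusX² ⊛^ k) n ⟩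
  (onePlusX² ⊛^ k) (2 + n) + (onePlusX² ⊛^ k) n   ≡⟨ cong₂ _+_ (onePlusX²^≗binomEven k (2 + n)) (onePlusX²^≗binomEven k n) ⟩
  binomEven k (2 + n) + binomEven k n             ≡⟨ binomEven-suc k n ⟨
  binomEven (suc k) (2 + n)                       ∎

p≤j⇒binomHalf≡0 : ∀ p .{{_ : NonZero p}} j → p ≤ j → binomHalf p j ≡ 0
p≤j⇒binomHalf≡0 p j p≤j = trans (binomHalf≗binomEven p j) (short j p≤j)
  where
  short : ∀ j → p ≤ j → binomEven (half p) j ≡ 0
  short j p≤j with parity j
  ... | odd k  = binomEven-odd (half p) k
  ... | even k = trans (binomEven-even (half p) k) (k>n⇒nCk≡0 (≰⇒> k≰half))
    where
    k≰half : ¬ k ≤ half p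
    k≰half k≤half = <⇒≱ (≤-<-trans k+k≤pred-p (subst (pred p <_) (suc-pred p) (n<1+n (pred p)))) p≤j
      where
      k+k≤pred-p : k + k ≤ pred p
      k+k≤pred-p = ≤-trans (+-mono-≤ k≤half k≤half) (subst (_≤ pred p) (sym (j+j≡j*2 (half p))) (m/n*n≤m (p ∸ 1) 2))

-- Binomial coefficients modulo a prime

n∣n! : ∀ n .{{_ : NonZero n}} → n ∣ n !
n∣n! (suc n) = m∣m*n (n !)

C*k!*[n∸k]!≡n! : ∀ {n k} → k ≤ n → (n C k) * (k ! * (n ∸ k) !) ≡ n !
C*k!*[n∸k]!≡n! {n} {k} k≤n = trans (cong (_* (k ! * (n ∸ k) !)) (nCk≡n!/k![n-k]! k≤n)) (m/n*n≡m (k![n∸k]!∣n! k≤n))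
  where instance _ = k !* (n ∸ k) !≢0

prime⇒1<p : ∀ {p} → Prime p → 1 < p
prime⇒1<p {p} prime-p = nonTrivial⇒n>1 p {{prime⇒nonTrivial prime-p}}

module _ {p} (prime-p : Prime p) where
  private instance _ = prime⇒nonZero prime-p

  prime∤! : ∀ m → m < p → p ∤ m !
  prime∤! zero _ p∣1 = <⇒≱ (prime⇒1<p prime-p) (∣⇒≤ p∣1)
  prime∤! (suc m) m<p p∣m! with euclidsLemma (suc m) (m !) prime-p p∣m!
  ... | inj₁ p∣1+m = <⇒≱ m<p (∣⇒≤ p∣1+m)
  ... | inj₂ p∣m!  = prime∤! m (<-trans (n<1+n m) m<p) p∣m!

  prime∣C : ∀ j → 0 < j → j < p → p ∣ (p C j)
  prime∣C j 0<j j<p with euclidsLemma (p C j) (j ! * (p ∸ j) !) prime-p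
                           (subst (p ∣_) (sym (C*k!*[n∸k]!≡n! (<⇒≤ j<p))) (n∣n! p))
  ... | inj₁ p∣C = p∣C
  ... | inj₂ p∣j![p∸j]! with euclidsLemma (j !) ((p ∸ j) !) prime-p p∣j![p∸j]!
  ...   | inj₁ p∣j! = contradiction p∣j! (prime∤! j j<p)
  ...   | inj₂ p∣[p∸j]! = contradiction p∣[p∸j]! (prime∤! (p ∸ j) (∸-monoʳ-< 0<j (<⇒≤ j<p)))

-- The substitution x ↦ x^p

module Inflation (p : ℕ) .{{_ : NonZero p}} where
  open Modulo p

  data Digits : ℕ → Set where
    digits : ∀ r q → r < p → Digits (r + q * p)

  toDigits : ∀ n → Digits n
  toDigits n = subst Digits (sym (m≡m%n+[m/n]*n n p)) (digits (n % p) (n / p) (m%n<n n p))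

  [r+qp]%p≡r : ∀ {r} q → r < p → (r + q * p) % p ≡ r
  [r+qp]%p≡r {r} q r<p = trans ([m+kn]%n≡m%n r q p) (m<n⇒m%n≡m r<p)

  [r+qp]/p≡q : ∀ {r} q → r < p → (r + q * p) / p ≡ q
  [r+qp]/p≡q {r} q r<p = trans (+-distrib-/-∣ʳ r (divides-refl q)) (cong₂ _+_ (m<n⇒m/n≡0 r<p) (m*n/n≡m q p))

  [r+qp]∸ip : ∀ r {q i} → i ≤ q → r + q * p ∸ i * p ≡ r + (q ∸ i) * p
  [r+qp]∸ip r {q} {i} i≤q = trans (+-∸-assoc r (*-monoˡ-≤ p i≤q)) (cong (r +_) (sym (*-distribʳ-∸ p q i)))

  ifZero : ℕ → ℕ → ℕ
  ifZero zero    x = x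
  ifZero (suc _) _ = 0

  -- Φ f = f(x^p)
  inflate : Series → Series
  inflate f n = ifZero (n % p) (f (n / p))

  inflate-digits : ∀ f {r} q → r < p → inflate f (r + q * p) ≡ ifZero r (f q)
  inflate-digits f q r<p = cong₂ ifZero ([r+qp]%p≡r q r<p) (cong f ([r+qp]/p≡q q r<p))

  inflate-cong : ∀ {f g} → f ≗ g → inflate f ≗ inflate g
  inflate-cong f≗g n = cong (ifZero (n % p)) (f≗g (n / p))

  0<p : 0 < p
  0<p = >-nonZero⁻¹ p

  0<j<p⇒0<j%p : ∀ {j} → 0 < j → j < p → 0 < j % p
  0<j<p⇒0<j%p 0<j j<p = subst (0 <_) (sym (m<n⇒m%n≡m j<p)) 0<j

  sumTo-multiples : ∀ φ → (∀ j → 0 < j % p → φ j ≡ 0) →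
                    ∀ {r} q → r < p → sumTo φ (suc (r + q * p)) ≡ sumTo (λ i → φ (i * p)) (suc q)
  sumTo-multiples φ vanish {r} zero r<p = begin
    sumTo φ (suc (r + 0))  ≡⟨ sumTo-head (suc (r + 0)) z<s (λ j 0<j j≤r → vanish j (0<j<p⇒0<j%p 0<j (<-≤-trans j≤r r+0<p))) ⟩
    φ 0                    ≡⟨ +-identityʳ (φ 0) ⟨
    φ 0 + 0                ∎
    where
    r+0<p : r + 0 < p
    r+0<p = subst (_< p) (sym (+-identityʳ r)) r<p
  sumTo-multiples φ vanish {r} (suc q) r<p = begin
    sumTo φ (suc (r + suc q * p))                       ≡⟨ cong (sumTo φ) regroup ⟩
    sumTo φ (p + suc (r + q * p))                       ≡⟨ sumTo-+ φ p (suc (r + q * p)) ⟩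
    sumTo φ p + sumTo (φ ∘ (p +_)) (suc (r + q * p))    ≡⟨ cong₂ _+_ (sumTo-head p 0<p λ j 0<j j<p → vanish j (0<j<p⇒0<j%p 0<j j<p))
                                                                     (sumTo-multiples (φ ∘ (p +_)) vanish′ q r<p) ⟩
    φ 0 + sumTo (λ i → φ (suc i * p)) (suc q)          ≡⟨ sumTo-suc (λ i → φ (i * p)) (suc q) ⟨
    sumTo (λ i → φ (i * p)) (suc (suc q))               ∎
    where
    regroup : suc (r + suc q * p) ≡ p + suc (r + q * p)
    regroup = trans (cong suc (x∙yz≈y∙xz r p (q * p))) (sym (+-suc p (r + q * p)))
    vanish′ : ∀ j → 0 < j % p → φ (p + j) ≡ 0
    vanish′ j 0<j%p = vanish (p + j) (subst (0 <_) (sym (trans (cong (_% p) (+-comm p j)) ([m+n]%n≡m%n j p))) 0<j%p)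

  inflate-⊛ : ∀ f g {r} q → r < p →
              (inflate f ⊛ g) (r + q * p) ≡ sumTo (λ i → f i * g (r + (q ∸ i) * p)) (suc q)
  inflate-⊛ f g {r} q r<p = begin
    (inflate f ⊛ g) n                                    ≡⟨ sumTo-multiples (λ j → inflate f j * g (n ∸ j)) vanish q r<p ⟩
    sumTo (λ i → inflate f (i * p) * g (n ∸ i * p)) (suc q)
      ≡⟨ sumTo-cong (suc q) (λ i i≤q → cong₂ _*_ (inflate-digits f i 0<p) (cong g ([r+qp]∸ip r (s≤s⁻¹ i≤q)))) ⟩
    sumTo (λ i → f i * g (r + (q ∸ i) * p)) (suc q)      ∎
    where
    n : ℕ
    n = r + q * p
    vanish : ∀ j → 0 < j % p → inflate f j * g (n ∸ j) ≡ 0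
    vanish j 0<j%p with j % p
    ... | suc _ = refl

  inflate-⊛-inflate : ∀ f g → (inflate f ⊛ inflate g) ≗ inflate (f ⊛ g)
  inflate-⊛-inflate f g n with toDigits n
  ... | digits r q r<p = begin
    (inflate f ⊛ inflate g) (r + q * p)                     ≡⟨ inflate-⊛ f (inflate g) q r<p ⟩
    sumTo (λ i → f i * inflate g (r + (q ∸ i) * p)) (suc q)
      ≡⟨ sumTo-cong (suc q) (λ i _ → cong (f i *_) (inflate-digits g (q ∸ i) r<p)) ⟩
    sumTo (λ i → f i * ifZero r (g (q ∸ i))) (suc q)        ≡⟨ convolve r ⟩
    ifZero r ((f ⊛ g) q)                                    ≡⟨ inflate-digits (f ⊛ g) q r<p ⟨
    inflate (f ⊛ g) (r + q * p)                             ∎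
    where
    convolve : ∀ r → sumTo (λ i → f i * ifZero r (g (q ∸ i))) (suc q) ≡ ifZero r ((f ⊛ g) q)
    convolve zero    = refl
    convolve (suc r) = sumTo-vanishing (suc q) λ i _ → *-zeroʳ (f i)

  inflate-⊛-deg<p : ∀ f {g} → (∀ j → p ≤ j → g j ≡ 0) → ∀ {r} q → r < p → (inflate f ⊛ g) (r + q * p) ≡ f q * g r
  inflate-⊛-deg<p f {g} deg<p {r} q r<p = begin
    (inflate f ⊛ g) (r + q * p)                       ≡⟨ inflate-⊛ f g q r<p ⟩
    sumTo (λ i → f i * g (r + (q ∸ i) * p)) (suc q)
      ≡⟨ sumTo-last q (λ i i<q → trans (cong (f i *_) (deg<p _ (p≤ i<q))) (*-zeroʳ (f i))) ⟩
    f q * g (r + (q ∸ q) * p)                        ≡⟨ cong (λ k → f q * g (r + k * p)) (n∸n≡0 q) ⟩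
    f q * g (r + 0)                                   ≡⟨ cong (λ k → f q * g k) (+-identityʳ r) ⟩
    f q * g r                                         ∎
    where
    p≤ : ∀ {i} → i < q → p ≤ r + (q ∸ i) * p
    p≤ {i} i<q = ≤-trans (m≤n*m p (q ∸ i) {{>-nonZero (m<n⇒0<n∸m i<q)}}) (m≤n+m ((q ∸ i) * p) r)

  inflation-fixed⇒oneS : 1 < p → ∀ f → f ≈ inflate f → f 0 % p ≡ 1 % p → f ≈ oneS
  inflation-fixed⇒oneS 1<p f f≈inflate-f f₀ = <-rec (λ n → f n % p ≡ oneS n % p) step
    where
    step : ∀ n → (∀ {m} → m < n → f m % p ≡ oneS m % p) → f n % p ≡ oneS n % p
    step n ih with toDigits n
    ... | digits (suc r) q r<p = trans (f≈inflate-f _) (cong (_% p) (inflate-digits f q r<p))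
    ... | digits zero zero _   = f₀
    ... | digits zero (suc q) _ = begin
      f (suc q * p) % p                 ≡⟨ f≈inflate-f (suc q * p) ⟩
      inflate f (suc q * p) % p         ≡⟨ cong (_% p) (inflate-digits f (suc q) 0<p) ⟩
      f (suc q) % p                     ≡⟨ ih (m<m*n (suc q) p 1<p) ⟩
      0 % p                             ≡⟨ cong (_% p) (oneS-pos (<-trans z<s (m<m*n (suc q) p 1<p))) ⟨
      oneS (suc q * p) % p              ∎
      where
      oneS-pos : ∀ {n} → 0 < n → oneS n ≡ 0
      oneS-pos {suc _} _ = refl

module _ {p} .{{_ : NonZero p}} (prime-p : Prime p) where
  open Modulo p
  open Inflation p

  inflate-onePlusX²-vanishing : ∀ n → n ≢ 0 → n ≢ p + p → inflate onePlusX² n ≡ 0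
  inflate-onePlusX²-vanishing n n≢0 n≢2p with toDigits n
  ... | digits (suc r) q r<p           = inflate-digits onePlusX² q r<p
  ... | digits zero zero _             = contradiction refl n≢0
  ... | digits zero 1 r<p              = inflate-digits onePlusX² 1 r<p
  ... | digits zero 2 _                = contradiction (cong (p +_) (+-identityʳ p)) n≢2p
  ... | digits zero (suc (suc (suc q))) r<p = inflate-digits onePlusX² (3 + q) r<p

  inflate-onePlusX²-2p : inflate onePlusX² (p + p) ≡ 1
  inflate-onePlusX²-2p = subst (λ n → inflate onePlusX² n ≡ 1) (cong (p +_) (+-identityʳ p))
                               (inflate-digits onePlusX² 2 0<p)

  binomEven-frobenius : binomEven p ≈ inflate onePlusX²
  binomEven-frobenius n with parity n
  ... | odd j = cong (_% p) (trans (binomEven-odd p j)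
                  (sym (inflate-onePlusX²-vanishing _ (λ ()) (λ eq → j+j≢1+k+k p j (sym eq)))))
  ... | even zero = cong (_% p) (sym (inflate-digits onePlusX² 0 0<p))
  ... | even (suc j) with <-cmp (suc j) p
  ...   | tri< j<p _ _ = begin
    binomEven p (suc j + suc j) % p     ≡⟨ cong (_% p) (binomEven-even p (suc j)) ⟩
    (p C suc j) % p                     ≡⟨ n∣m⇒m%n≡0 _ p (prime∣C prime-p (suc j) z<s j<p) ⟩
    0                                   ≡⟨ m*n%n≡0 0 p ⟨
    0 % p                               ≡⟨ cong (_% p) (inflate-onePlusX²-vanishing _ (λ ()) (<⇒≢ (+-mono-< j<p j<p))) ⟨
    inflate onePlusX² (suc j + suc j) % p ∎
  ...   | tri≈ _ refl _ = cong (_% p) (trans (binomEven-even p p) (trans (nCn≡1 p) (sym inflate-onePlusX²-2p)))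
  ...   | tri> _ _ j>p = cong (_% p) (trans (binomEven-even p (suc j)) (trans (k>n⇒nCk≡0 j>p)
                           (sym (inflate-onePlusX²-vanishing _ (λ ()) (>⇒≢ (+-mono-< j>p j>p))))))

-- The p-Cantor sequence

at-++ˡ : ∀ xs ys {i} → i < length xs → at (xs ++ ys) i ≡ at xs i
at-++ˡ (x ∷ xs) ys {zero}  _         = refl
at-++ˡ (x ∷ xs) ys {suc i} (s<s i<n) = at-++ˡ xs ys i<n

at-++ʳ : ∀ xs ys i → at (xs ++ ys) (length xs + i) ≡ at ys i
at-++ʳ []       ys i = refl
at-++ʳ (x ∷ xs) ys i = at-++ʳ xs ys i

at-applyUpTo : ∀ f {n i} → i < n → at (applyUpTo f n) i ≡ f i
at-applyUpTo f {suc n} {zero}  _         = refl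
at-applyUpTo f {suc n} {suc i} (s<s i<n) = at-applyUpTo (f ∘ suc) i<n

module CantorSequence (p : ℕ) .{{_ : NonZero p}} where
  open Modulo p
  open Inflation p

  length-φletter : ∀ a → length (φletter p a) ≡ p
  length-φletter a = trans (length-map _ (upTo p)) (length-upTo p)

  at-φletter : ∀ a {r} → r < p → at (φletter p a) r ≡ (a * binomHalf p r) % p
  at-φletter a r<p = trans (cong (λ w → at w _) (map-upTo (λ i → (a * binomHalf p i) % p) p))
                           (at-applyUpTo (λ i → (a * binomHalf p i) % p) r<p)

  at-φword : ∀ v {r} q → r < p → at (φword p v) (r + q * p) ≡ (at v q * binomHalf p r) % p
  at-φword []      q       r<p = sym (m*n%n≡0 0 p)
  at-φword (a ∷ v) {r} zero r<p = begin
    at (φletter p a ++ φword p v) (r + 0)  ≡⟨ cong (at (φletter p a ++ φword p v)) (+-identityʳ r) ⟩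
    at (φletter p a ++ φword p v) r        ≡⟨ at-++ˡ (φletter p a) (φword p v) (subst (r <_) (sym (length-φletter a)) r<p) ⟩
    at (φletter p a) r                     ≡⟨ at-φletter a r<p ⟩
    (a * binomHalf p r) % p                ∎
  at-φword (a ∷ v) {r} (suc q) r<p = begin
    at (φletter p a ++ φword p v) (r + suc q * p)                    ≡⟨ cong (at (φletter p a ++ φword p v)) regroup ⟩
    at (φletter p a ++ φword p v) (length (φletter p a) + (r + q * p)) ≡⟨ at-++ʳ (φletter p a) (φword p v) (r + q * p) ⟩
    at (φword p v) (r + q * p)                                       ≡⟨ at-φword v q r<p ⟩
    (at v q * binomHalf p r) % p                                     ∎
    where
    regroup : r + suc q * p ≡ length (φletter p a) + (r + q * p)
    regroup = trans (x∙yz≈y∙xz r p (q * p)) (cong (_+ (r + q * p)) (sym (length-φletter a)))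

  module _ (1<p : 1 < p) where

    quotient≤ : ∀ {r} q {k} → r + q * p ≤ suc k → q ≤ k
    quotient≤ zero    _     = z≤n
    quotient≤ {r} (suc q) r+qp≤1+k = s≤s⁻¹ (<-≤-trans (<-≤-trans (m<m*n (suc q) p 1<p) (m≤n+m _ r)) r+qp≤1+k)

    at-φiter-suc : ∀ k {i} → i ≤ k → at (φiter p (suc k)) i ≡ at (φiter p k) i
    at-φiter-suc zero    z≤n = trans (at-φword (1 ∷ []) 0 0<p) (m<n⇒m%n≡m 1<p)
    at-φiter-suc (suc k) {i} i≤1+k with toDigits i
    ... | digits r q r<p = begin
      at (φiter p (2 + k)) (r + q * p)                ≡⟨ at-φword (φiter p (suc k)) q r<p ⟩
      (at (φiter p (suc k)) q * binomHalf p r) % p    ≡⟨ cong (λ x → (x * binomHalf p r) % p) (at-φiter-suc k (quotient≤ q i≤1+k)) ⟩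
      (at (φiter p k) q * binomHalf p r) % p          ≡⟨ at-φword (φiter p k) q r<p ⟨
      at (φiter p (suc k)) (r + q * p)                ∎

    at-φiter-diagonal : ∀ {i k} → i ≤ k → at (φiter p k) i ≡ at (φiter p i) i
    at-φiter-diagonal {i} {k} i≤k = subst (λ n → at (φiter p n) i ≡ at (φiter p i) i) (m∸n+n≡m i≤k) (later (k ∸ i))
      where
      later : ∀ d → at (φiter p (d + i)) i ≡ at (φiter p i) i
      later zero    = refl
      later (suc d) = trans (at-φiter-suc (d + i) (m≤n+m i d)) (later d)

    cantor≡diagonal : ∀ i → cantor p i ≡ at (φiter p i) i
    cantor≡diagonal i = at-φiter-suc i ≤-refl

    cantor-0 : cantor p 0 ≡ 1
    cantor-0 = cantor≡diagonal 0

    cantor-digit : ∀ {r} q → r < p → cantor p (r + q * p) ≡ (cantor p q * binomHalf p r) % p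
    cantor-digit {r} q r<p = begin
      at (φword p (φiter p n)) (r + q * p)     ≡⟨ at-φword (φiter p n) q r<p ⟩
      (at (φiter p n) q * binomHalf p r) % p   ≡⟨ cong (λ x → (x * binomHalf p r) % p) (at-φiter-diagonal q≤n) ⟩
      (at (φiter p q) q * binomHalf p r) % p   ≡⟨ cong (λ x → (x * binomHalf p r) % p) (cantor≡diagonal q) ⟨
      (cantor p q * binomHalf p r) % p         ∎
      where
      n : ℕ
      n = r + q * p
      q≤n : q ≤ n
      q≤n = ≤-trans (m≤m*n q p) (m≤n+m (q * p) r)

    cantor≈binomHalf⊛inflate : cantor p ≈ (binomHalf p ⊛ inflate (cantor p))
    cantor≈binomHalf⊛inflate n with toDigits n
    ... | digits r q r<p = begin
      cantor p (r + q * p) % p                          ≡⟨ cong (_% p) (cantor-digit q r<p) ⟩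
      (cantor p q * binomHalf p r) % p % p              ≡⟨ m%n%n≡m%n _ p ⟩
      (cantor p q * binomHalf p r) % p                  ≡⟨ cong (_% p) (inflate-⊛-deg<p (cantor p) (p≤j⇒binomHalf≡0 p) q r<p) ⟨
      (inflate (cantor p) ⊛ binomHalf p) (r + q * p) % p ≡⟨ cong (_% p) (⊛-comm (inflate (cantor p)) (binomHalf p) (r + q * p)) ⟩
      (binomHalf p ⊛ inflate (cantor p)) (r + q * p) % p ∎

half+half≡pred : ∀ p → p % 2 ≡ 1 → half p + half p ≡ pred p
half+half≡pred p p%2≡1 with parity p
... | even j = contradiction (trans (sym p%2≡1) ([j+j]%2≡0 j)) λ ()
... | odd j  = cong (λ x → x + x) ([j+j]/2≡j j)

module OddPrime (p : ℕ) .{{_ : NonZero p}} (prime-p : Prime p) (p%2≡1 : p % 2 ≡ 1) where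
  open Modulo p
  open Inflation p
  open CantorSequence p
  open CommutativeMonoid ⊛-1-commutativeMonoid-≈ using (∙-cong; ∙-congʳ; comm)

  B Q c : Series
  B = binomHalf p
  Q = onePlusX²
  c = cantor p

  1<p : 1 < p
  1<p = prime⇒1<p prime-p

  binomHalf²⊛onePlusX²≈inflate : ((B ⊛ B) ⊛ Q) ≈ inflate Q
  binomHalf²⊛onePlusX²≈inflate n = begin
    ((B ⊛ B) ⊛ Q) n % p                  ≡⟨ ∙-congʳ {Q} (≗⇒≈ (⊛-cong B≗Qʰ B≗Qʰ)) n ⟩
    (((Q ⊛^ h) ⊛ (Q ⊛^ h)) ⊛ Q) n % p    ≡⟨ ∙-congʳ {Q} (≗⇒≈ (λ m → sym (×-homo-+ Q h h m))) n ⟩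
    ((Q ⊛^ (h + h)) ⊛ Q) n % p           ≡⟨ comm (Q ⊛^ (h + h)) Q n ⟩
    (Q ⊛^ suc (h + h)) n % p             ≡⟨ cong (λ k → (Q ⊛^ k) n % p) (trans (cong suc (half+half≡pred p p%2≡1)) (suc-pred p)) ⟩
    (Q ⊛^ p) n % p                       ≡⟨ cong (_% p) (onePlusX²^≗binomEven p n) ⟩
    binomEven p n % p                    ≡⟨ binomEven-frobenius prime-p n ⟩
    inflate Q n % p                      ∎
    where
    h : ℕ
    h = half p
    B≗Qʰ : B ≗ Q ⊛^ h
    B≗Qʰ n = trans (binomHalf≗binomEven p n) (sym (onePlusX²^≗binomEven h n))

  rearrange : ∀ x y z → ((x ⊛ y) ⊛ (x ⊛ y)) ⊛ z ≈ ((x ⊛ x) ⊛ z) ⊛ (y ⊛ y)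
  rearrange x y z = prove 3 (((b ⊕ e) ⊕ (b ⊕ e)) ⊕ q) (((b ⊕ b) ⊕ q) ⊕ (e ⊕ e)) (x ∷ y ∷ z ∷ [])
    where
    open import Algebra.Solver.CommutativeMonoid ⊛-1-commutativeMonoid-≈ using (Expr; prove; var; _⊕_)
    open import Data.Fin using (zero; suc)
    open import Data.Vec using ([]; _∷_)
    b e q : Expr 3
    b = var zero
    e = var (suc zero)
    q = var (suc (suc zero))

  S : Series
  S = (c ⊛ c) ⊛ Q

  S₀ : S 0 ≡ 1
  S₀ = cong (λ c₀ → (c₀ * c₀ + 0) * 1 + 0) (cantor-0 1<p)

  S≈inflate-S : S ≈ inflate S
  S≈inflate-S n = begin
    ((c ⊛ c) ⊛ Q) n % p                                ≡⟨ ∙-congʳ {Q} (∙-cong c≈ c≈) n ⟩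
    (((B ⊛ inflate c) ⊛ (B ⊛ inflate c)) ⊛ Q) n % p    ≡⟨ rearrange B (inflate c) Q n ⟩
    (((B ⊛ B) ⊛ Q) ⊛ (inflate c ⊛ inflate c)) n % p    ≡⟨ ∙-congʳ {inflate c ⊛ inflate c} binomHalf²⊛onePlusX²≈inflate n ⟩
    (inflate Q ⊛ (inflate c ⊛ inflate c)) n % p
      ≡⟨ cong (_% p) (⊛-cong {f = inflate Q} (λ _ → refl) (inflate-⊛-inflate c c) n) ⟩
    (inflate Q ⊛ inflate (c ⊛ c)) n % p                ≡⟨ cong (_% p) (inflate-⊛-inflate Q (c ⊛ c) n) ⟩
    inflate (Q ⊛ (c ⊛ c)) n % p                        ≡⟨ cong (_% p) (inflate-cong (⊛-comm Q (c ⊛ c)) n) ⟩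
    inflate S n % p                                    ∎
    where
    c≈ : c ≈ (B ⊛ inflate c)
    c≈ = cantor≈binomHalf⊛inflate 1<p

lemma3p12 : (p : ℕ) .{{_ : NonZero p}} → Prime p → p % 2 ≡ 1 →
    IsInvSqrtOnePlusX² p (Θ p)
lemma3p12 p prime-p p%2≡1 =
  cong (_% p) (cantor-0 1<p) , inflation-fixed⇒oneS 1<p S S≈inflate-S (cong (_% p) S₀)
  where
  open OddPrime p prime-p p%2≡1
  open Inflation p using (inflation-fixed⇒oneS)
  open CantorSequence p using (cantor-0)
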